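{- Let $v\ge 2$, $s_1\ge\dots\ge s_v\ge 1$ be integers, $\mathbf s=(s_1,\dots,s_v)$, $c=\Sigma(\mathbf s)$, and $m\le c$. Minimize $\Pr(\mathbf b,\mathbf s)$ over all bid $v$-vectors $\mathbf b$ (non-negative integer entries) with $\Sigma(\mathbf b)=m$. The minimum is $0$ if and only if $m>c-s_1$; it is achieved by $\mathbf b$ if and only if there is some $i\in\{1,\dots,v\}$ with $b_i>c-s_i$. If $m\le c-s_1$, then the minimum is $\prod_{i=0}^{m-1}\frac{c-s_1-i}{c-i}$, and it is achieved by $\mathbf b$ if and only if there is an index $j$ with $s_j=s_1$ and $b_j=m$ (while $b_i=0$ for all $i\ne j$).
   Context: For a vector $\mathbf s=(s_1,\dots,s_v)$ of non-negative integers, the $\mathbf s$-deck consists of $s_i$ cards of Value $i$; $\Sigma(\mathbf s)=s_1+\dots+s_v$. In the $m$-round $\mathbf s$-game, the deck is shuffled uniformly at random; in each of $m$ rounds the player names a value and then the top remaining card is turned; the player loses if in some round the turned card has the named value, and wins otherwise. An advance bid is encoded by a vector $\mathbf b=(b_1,\dots,b_v)$ of non-negative integers with $\Sigma(\mathbf b)=m$, where $b_i$ is the number of times Value $i$ is named (the sequence of bids is fixed in advance; the winning probability does not depend on its order). $\Pr(\mathbf b,\mathbf s)$ denotes the probability that the advance bid $\mathbf b$ wins the $m$-round $\mathbf s$-game. -}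

module Defs where

open import Data.Nat as ℕ using (ℕ; zero; suc; _∸_; _≤_; _<_)
open import Data.Fin as Fin using (Fin; fromℕ<)
open import Data.Bool using (Bool; true; false; not; _∧_)
open import Data.List using (List; []; _∷_; map; concatMap; replicate; length; filterᵇ; allFin; zip)
open import Data.Product using (_×_; _,_; Σ; ∃; ∃-syntax)
open import Data.Nat.ListAction using (sum)
open import Data.Integer using (+_)
open import Data.Rational using (ℚ; _/_; _*_; 1ℚ; _≤_)
open import Relation.Nullary using (does)
open import Relation.Binary.PropositionalEquality using (_≡_)

Σv : ∀ {v} → (Fin v → ℕ) → ℕ
Σv {v} s = sum (map s (allFin v))

-- The list consisting of s_i copies of Value i, for i = 1..v (Fin index i ↔ Value i+1).
multiset : ∀ {v} → (Fin v → ℕ) → List (Fin v)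
multiset {v} s = concatMap (λ i → replicate (s i) i) (allFin v)

insertions : ∀ {A : Set} → A → List A → List (List A)
insertions x [] = (x ∷ []) ∷ []
insertions x (y ∷ ys) = (x ∷ y ∷ ys) ∷ map (y ∷_) (insertions x ys)

-- all c! orderings of a list of c (labelled) cards, with multiplicity:
-- the uniform distribution on this list is the uniformly random shuffle.
perms : ∀ {A : Set} → List A → List (List A)
perms [] = [] ∷ []
perms (x ∷ xs) = concatMap (insertions x) (perms xs)

-- the bid sequence named in rounds 1..m: b_1 times Value 1, then b_2 times Value 2, ...
bidSeq : ∀ {v} → (Fin v → ℕ) → List (Fin v)
bidSeq = multiset

-- an advance bid sequence wins against a shuffled deck iff in no round the turned
-- card equals the named value (the rounds are the first length(bids) cards).
wins : ∀ {v} → List (Fin v) → List (Fin v) → Bool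
wins bids deck = allB (zip bids deck)
  where
  allB : List (Fin _ × Fin _) → Bool
  allB [] = true
  allB ((x , y) ∷ r) = not (does (x Fin.≟ y)) ∧ allB r

-- a / d as a rational; junk value 0 when d = 0 (never used with d = 0)
frac : ℕ → ℕ → ℚ
frac a zero = Data.Rational.0ℚ
frac a (suc d) = + a / suc d

Pr : ∀ {v} → (Fin v → ℕ) → (Fin v → ℕ) → ℚ
Pr b s = frac (length (filterᵇ (wins (bidSeq b)) (perms (multiset s))))
              (length (perms (multiset s)))

prodℚ : ℕ → (ℕ → ℚ) → ℚ
prodℚ zero f = 1ℚ
prodℚ (suc k) f = prodℚ k f * f k

IsMinPr : ∀ {v} → (Fin v → ℕ) → ℕ → ℚ → Set
IsMinPr {v} s m μ =
  (∃[ b ] (Σv b ≡ m × Pr b s ≡ μ)) ×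
  (∀ (b : Fin v → ℕ) → Σv b ≡ m → μ Data.Rational.≤ Pr b s)

first : ∀ {v} → 2 ℕ.≤ v → Fin v
first {suc v} _ = Fin.zero

-- Let W(bs, s) be the number of shuffles of the c labelled cards on which the bid sequence bs wins.
-- Conditioning on the top card gives W(a ∷ bs, s) = Σ_{j ≠ a} s_j · W(bs, s − e_j). Induction on the
-- bids then shows W ≥ ((c − K) P′ m) · (c − m)! whenever every s_j ≤ K, with equality when all m bids
-- name one Value with K cards; if m ≤ c − K, equality forces every step of the induction to be tight,
-- which happens only for such constant bids. Dividing by c! = (c P′ m) · (c − m)! gives the product.
-- Separately, W = 0 exactly when some Value i is named more than c − s_i times: its cards cannot avoid
-- the rounds naming it, and otherwise drawing first the (at most one) Value with no room to spare, or
-- else any Value other than the first bid, keeps every Value within its room.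

module Submission where

open import Defs
open import Data.Bool using (Bool; true; false; if_then_else_)
open import Data.Empty using (⊥; ⊥-elim)
open import Data.Fin using (Fin)
import Data.Fin as F
open import Data.Fin.Properties using (any?)
open import Data.List using (List; []; _∷_; map; concatMap; replicate; length; filterᵇ; allFin; _++_)
open import Data.List.Properties using (map-cong; map-cong-local; map-∘; map-++; length-++; length-replicate; ++-identityʳ)
open import Data.List.Membership.Propositional using (_∈_)
open import Data.List.Membership.Propositional.Properties using (∈-allFin)
open import Data.List.Relation.Unary.All as All using (All; []; _∷_)
open import Data.List.Relation.Unary.Any using (here; there)
open import Data.List.Relation.Unary.AllPairs using ([]; _∷_)
open import Data.List.Relation.Unary.Unique.Propositional using (Unique)
open import Data.List.Relation.Unary.Unique.Propositional.Properties using (allFin⁺)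
open import Data.Nat using (ℕ; zero; suc; pred; _+_; _*_; _∸_; _≤_; _<_; _!; z≤n; s≤s; s≤s⁻¹; _<?_; >-nonZero)
open import Data.Nat.Combinatorics.Base using (_P′_)
open import Data.Nat.ListAction using (sum)
open import Data.Nat.ListAction.Properties using (sum-++)
open import Data.Nat.Properties
open import Algebra.Properties.CommutativeSemigroup +-commutativeSemigroup using (interchange; xy∙z≈zy∙x)
open import Algebra.Properties.CommutativeSemigroup *-commutativeSemigroup using (x∙yz≈y∙xz; x∙yz≈xz∙y)
import Data.Integer as ℤ
import Data.Integer.Properties as ℤ
open import Data.Rational as ℚ using (ℚ; 0ℚ; toℚᵘ)
open import Data.Rational.Properties using (toℚᵘ-fromℚᵘ; toℚᵘ-cancel-≤; toℚᵘ-injective; toℚᵘ-homo-*)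
open import Data.Rational.Unnormalised as ℚᵘ using (mkℚᵘ; *≡*; *≤*)
import Data.Rational.Unnormalised.Properties as ℚᵘ
open import Data.Product using (_×_; _,_; ∃; ∃-syntax; proj₁; proj₂)
open import Function using (_∘_; const; _⇔_; mk⇔; Equivalence)
open import Relation.Binary.PropositionalEquality
open import Relation.Nullary using (Dec; yes; no; does)

private
  variable
    A B : Set
    v : ℕ

sum-map-+ : ∀ (f g : A → ℕ) l → sum (map (λ x → f x + g x) l) ≡ sum (map f l) + sum (map g l)
sum-map-+ f g []      = refl
sum-map-+ f g (x ∷ l) = trans (cong (f x + g x +_) (sum-map-+ f g l)) (interchange (f x) (g x) _ _)

sum-map-*ʳ : ∀ (f : A → ℕ) k l → sum (map (λ x → f x * k) l) ≡ sum (map f l) * k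
sum-map-*ʳ f k []      = refl
sum-map-*ʳ f k (x ∷ l) = trans (cong (f x * k +_) (sum-map-*ʳ f k l)) (sym (*-distribʳ-+ k (f x) _))

sum-map-*ˡ : ∀ (f : A → ℕ) k l → sum (map (λ x → k * f x) l) ≡ k * sum (map f l)
sum-map-*ˡ f k []      = sym (*-zeroʳ k)
sum-map-*ˡ f k (x ∷ l) = trans (cong (k * f x +_) (sum-map-*ˡ f k l)) (sym (*-distribˡ-+ k (f x) _))

sum-map-++ : ∀ (f : A → ℕ) l l′ → sum (map f (l ++ l′)) ≡ sum (map f l) + sum (map f l′)
sum-map-++ f l l′ = trans (cong sum (map-++ f l l′)) (sum-++ (map f l) (map f l′))

sum-map-mono : ∀ {f g : A → ℕ} → (∀ x → f x ≤ g x) → ∀ l → sum (map f l) ≤ sum (map g l)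
sum-map-mono f≤g []      = z≤n
sum-map-mono f≤g (x ∷ l) = +-mono-≤ (f≤g x) (sum-map-mono f≤g l)

sum-map-zero : ∀ {f : A → ℕ} → (∀ x → f x ≡ 0) → ∀ l → sum (map f l) ≡ 0
sum-map-zero f≡0 []      = refl
sum-map-zero {f = f} f≡0 (x ∷ l) = trans (cong (_+ sum (map f l)) (f≡0 x)) (sum-map-zero f≡0 l)

∈⇒≤sum-map : ∀ (f : A → ℕ) {x l} → x ∈ l → f x ≤ sum (map f l)
∈⇒≤sum-map f {l = y ∷ l} (here refl) = m≤m+n (f y) _
∈⇒≤sum-map f {l = y ∷ l} (there x∈) = ≤-trans (∈⇒≤sum-map f x∈) (m≤n+m _ (f y))

sum-map>0⇒∃>0 : ∀ (f : A → ℕ) l → 0 < sum (map f l) → ∃[ x ] 0 < f x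
sum-map>0⇒∃>0 f (x ∷ l) sum>0 with f x in fx≡
... | suc _ = x , subst (0 <_) (sym fx≡) (s≤s z≤n)
... | zero  = sum-map>0⇒∃>0 f l sum>0

sum-map-mono-tight : ∀ {f g : A → ℕ} → (∀ x → g x ≤ f x) → ∀ l →
                     sum (map f l) ≤ sum (map g l) → All (λ x → f x ≤ g x) l
sum-map-mono-tight g≤f []      _ = []
sum-map-mono-tight {f = f} {g = g} g≤f (x ∷ l) Σf≤Σg =
  +-cancelʳ-≤ _ (f x) (g x) (≤-trans Σf≤Σg (+-monoʳ-≤ (g x) (sum-map-mono g≤f l))) ∷
  sum-map-mono-tight g≤f l (+-cancelˡ-≤ (f x) _ _ (≤-trans Σf≤Σg (+-monoˡ-≤ _ (g≤f x))))

sum-map-replicate : ∀ (f : A → ℕ) n x → sum (map f (replicate n x)) ≡ n * f x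
sum-map-replicate f zero    x = refl
sum-map-replicate f (suc n) x = cong (f x +_) (sum-map-replicate f n x)

sum-map-concatMap : ∀ (f : B → ℕ) (h : A → List B) l →
                    sum (map f (concatMap h l)) ≡ sum (map (λ x → sum (map f (h x))) l)
sum-map-concatMap f h []      = refl
sum-map-concatMap f h (x ∷ l) =
  trans (sum-map-++ f (h x) (concatMap h l)) (cong (sum (map f (h x)) +_) (sum-map-concatMap f h l))

sum-map-update : ∀ (f g : A → ℕ) {j l} → Unique l → j ∈ l → (∀ i → i ≢ j → f i ≡ g i) →
                 sum (map f l) + g j ≡ sum (map g l) + f j
sum-map-update f g {l = i ∷ l} (i∉ ∷ _) (here refl) f≡g =
  trans (cong (λ t → f i + t + g i) (cong sum (map-cong-local (All.map (λ i≢k → f≡g _ (i≢k ∘ sym)) i∉))))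
        (xy∙z≈zy∙x (f i) _ (g i))
sum-map-update f g {j} {i ∷ l} (i∉ ∷ uniq) (there j∈) f≡g = begin
    f i + sum (map f l) + g j   ≡⟨ +-assoc (f i) _ _ ⟩
    f i + (sum (map f l) + g j) ≡⟨ cong₂ _+_ (f≡g i (All.lookup i∉ j∈)) (sum-map-update f g uniq j∈ f≡g) ⟩
    g i + (sum (map g l) + f j) ≡⟨ +-assoc (g i) _ _ ⟨
    g i + sum (map g l) + f j   ∎
  where open ≡-Reasoning

length≡sum-map-1 : ∀ (l : List A) → length l ≡ sum (map (const 1) l)
length≡sum-map-1 []      = refl
length≡sum-map-1 (x ∷ l) = cong suc (length≡sum-map-1 l)

-- Permutations

sumPicks : (A → List A → ℕ) → List A → ℕ
sumPicks g []       = 0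
sumPicks g (x ∷ xs) = g x xs + sumPicks (λ y r → g y (x ∷ r)) xs

sumPicks-cong : ∀ {g g′ : A → List A → ℕ} → (∀ y r → g y r ≡ g′ y r) → ∀ l → sumPicks g l ≡ sumPicks g′ l
sumPicks-cong g≡g′ []       = refl
sumPicks-cong g≡g′ (x ∷ xs) = cong₂ _+_ (g≡g′ x xs) (sumPicks-cong (λ y r → g≡g′ y (x ∷ r)) xs)

sumPicks-++ : ∀ (g : A → List A → ℕ) xs ys →
              sumPicks g (xs ++ ys) ≡ sumPicks (λ y r → g y (r ++ ys)) xs + sumPicks (λ y r → g y (xs ++ r)) ys
sumPicks-++ g []       ys = refl
sumPicks-++ g (x ∷ xs) ys =
  trans (cong (g x (xs ++ ys) +_) (sumPicks-++ (λ y r → g y (x ∷ r)) xs ys)) (sym (+-assoc (g x (xs ++ ys)) _ _))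

sumPicks-replicate : ∀ (g : A → List A → ℕ) n x → sumPicks g (replicate n x) ≡ n * g x (replicate (n ∸ 1) x)
sumPicks-replicate g zero          x = refl
sumPicks-replicate g (suc zero)    x = refl
sumPicks-replicate g (suc (suc n)) x =
  cong (g x (replicate (suc n) x) +_) (sumPicks-replicate (λ y r → g y (x ∷ r)) (suc n) x)

sumPicks-const : ∀ (g : A → List A → ℕ) k l → (∀ y r → suc (length r) ≡ length l → g y r ≡ k) →
                 sumPicks g l ≡ length l * k
sumPicks-const g k []       _ = refl
sumPicks-const g k (x ∷ xs) g≡k =
  cong₂ _+_ (g≡k x xs refl) (sumPicks-const _ k xs (λ y r eq → g≡k y (x ∷ r) (cong suc eq)))

sumPerms : (List A → ℕ) → List A → ℕ
sumPerms h l = sum (map h (perms l))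

laterInsertions : (List A → ℕ) → A → List A → ℕ
laterInsertions h x []      = 0
laterInsertions h x (y ∷ σ) = sum (map (h ∘ (y ∷_)) (insertions x σ))

sum-insertions : ∀ (h : List A → ℕ) x σ → sum (map h (insertions x σ)) ≡ h (x ∷ σ) + laterInsertions h x σ
sum-insertions h x []      = refl
sum-insertions h x (y ∷ σ) = cong (h (x ∷ y ∷ σ) +_) (cong sum (sym (map-∘ (insertions x σ))))

sumPerms-∷ : ∀ (h : List A → ℕ) x xs →
             sumPerms h (x ∷ xs) ≡ sumPicks (λ y r → sumPerms (h ∘ (y ∷_)) r) (x ∷ xs)
sumPerms-∷ h x xs = begin
    sum (map h (concatMap (insertions x) (perms xs)))
  ≡⟨ sum-map-concatMap h (insertions x) (perms xs) ⟩
    sum (map (λ σ → sum (map h (insertions x σ))) (perms xs))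
  ≡⟨ cong sum (map-cong (sum-insertions h x) (perms xs)) ⟩
    sum (map (λ σ → h (x ∷ σ) + laterInsertions h x σ) (perms xs))
  ≡⟨ sum-map-+ (h ∘ (x ∷_)) (laterInsertions h x) (perms xs) ⟩
    sumPerms (h ∘ (x ∷_)) xs + sumPerms (laterInsertions h x) xs
  ≡⟨ cong (sumPerms (h ∘ (x ∷_)) xs +_) (later xs) ⟩
    sumPicks (λ y r → sumPerms (h ∘ (y ∷_)) r) (x ∷ xs)
  ∎
  where
  open ≡-Reasoning
  later : ∀ xs → sumPerms (laterInsertions h x) xs ≡ sumPicks (λ y r → sumPerms (h ∘ (y ∷_)) (x ∷ r)) xs
  later []       = refl
  later (z ∷ zs) = trans (sumPerms-∷ (laterInsertions h x) z zs)
    (sumPicks-cong (λ y r → sym (sum-map-concatMap (h ∘ (y ∷_)) (insertions x) (perms r))) (z ∷ zs))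

sumPerms-1 : ∀ (l : List A) → sumPerms (const 1) l ≡ length l !
sumPerms-1 l = ofLength _ l refl
  where
  ofLength : ∀ n (l : List A) → length l ≡ n → sumPerms (const 1) l ≡ n !
  ofLength zero    []       _  = refl
  ofLength (suc n) (x ∷ xs) eq = trans (sumPerms-∷ (const 1) x xs)
    (trans (sumPicks-const _ (n !) (x ∷ xs) (λ y r eq′ → ofLength n r (suc-injective (trans eq′ eq))))
           (cong (_* n !) eq))

length-perms : ∀ (l : List A) → length (perms l) ≡ length l !
length-perms l = trans (length≡sum-map-1 (perms l)) (sumPerms-1 l)

_∖_ : (Fin v → ℕ) → Fin v → Fin v → ℕ
(s ∖ j) i = if does (i F.≟ j) then s i ∸ 1 else s i

∖-self : ∀ (s : Fin v → ℕ) j → (s ∖ j) j ≡ s j ∸ 1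
∖-self s j with j F.≟ j
... | yes _  = refl
... | no j≢j = ⊥-elim (j≢j refl)

∖-other : ∀ (s : Fin v → ℕ) {i j} → i ≢ j → (s ∖ j) i ≡ s i
∖-other s {i} {j} i≢j with i F.≟ j
... | yes i≡j = ⊥-elim (i≢j i≡j)
... | no _    = refl

∖-≤ : ∀ (s : Fin v → ℕ) j i → (s ∖ j) i ≤ s i
∖-≤ s j i with i F.≟ j
... | yes _ = m∸n≤m (s i) 1
... | no _  = ≤-refl

∖-≤-bound : ∀ {s : Fin v → ℕ} {K} → (∀ i → s i ≤ K) → ∀ j i → (s ∖ j) i ≤ K
∖-≤-bound {s = s} s≤K j i = ≤-trans (∖-≤ s j i) (s≤K i)

δ δᶜ : Fin v → Fin v → ℕ
δ  i j = if does (i F.≟ j) then 1 else 0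
δᶜ i j = if does (i F.≟ j) then 0 else 1

δ-refl : ∀ (i : Fin v) → δ i i ≡ 1
δ-refl i with i F.≟ i
... | yes _  = refl
... | no i≢i = ⊥-elim (i≢i refl)

δ-≢ : ∀ {i j : Fin v} → i ≢ j → δ i j ≡ 0
δ-≢ {i = i} {j} i≢j with i F.≟ j
... | yes i≡j = ⊥-elim (i≢j i≡j)
... | no _    = refl

δᶜ-refl : ∀ (i : Fin v) → δᶜ i i ≡ 0
δᶜ-refl i with i F.≟ i
... | yes _  = refl
... | no i≢i = ⊥-elim (i≢i refl)

δᶜ-≢ : ∀ {i j : Fin v} → i ≢ j → δᶜ i j ≡ 1
δᶜ-≢ {i = i} {j} i≢j with i F.≟ j
... | yes i≡j = ⊥-elim (i≢j i≡j)
... | no _    = refl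

*-δ-refl : ∀ n (i : Fin v) → n * δ i i ≡ n
*-δ-refl n i = trans (cong (n *_) (δ-refl i)) (*-identityʳ n)

*-δ-≢ : ∀ n {i j : Fin v} → i ≢ j → n * δ i j ≡ 0
*-δ-≢ n i≢j = trans (cong (n *_) (δ-≢ i≢j)) (*-zeroʳ n)

*-δᶜ-refl : ∀ n (i : Fin v) → n * δᶜ i i ≡ 0
*-δᶜ-refl n i = trans (cong (n *_) (δᶜ-refl i)) (*-zeroʳ n)

*-δᶜ-≢ : ∀ n {i j : Fin v} → i ≢ j → n * δᶜ i j ≡ n
*-δᶜ-≢ n i≢j = trans (cong (n *_) (δᶜ-≢ i≢j)) (*-identityʳ n)

δᶜ-*-≢ : ∀ n {i j : Fin v} → i ≢ j → δᶜ i j * n ≡ n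
δᶜ-*-≢ n i≢j = trans (cong (_* n) (δᶜ-≢ i≢j)) (*-identityˡ n)

Σv-update : ∀ (f g : Fin v → ℕ) j → (∀ i → i ≢ j → f i ≡ g i) → Σv f + g j ≡ Σv g + f j
Σv-update {v} f g j = sum-map-update f g (allFin⁺ v) (∈-allFin j)

≤Σv : ∀ (s : Fin v → ℕ) j → s j ≤ Σv s
≤Σv {v} s j = ∈⇒≤sum-map s (∈-allFin j)

Σv-∖ : ∀ (s : Fin v → ℕ) {j c} → Σv s ≡ suc c → 1 ≤ s j → Σv (s ∖ j) ≡ c
Σv-∖ s {j} {c} Σs≡ 1≤sj = +-cancelʳ-≡ (s j ∸ 1) _ _ (suc-injective (begin
    suc (Σv (s ∖ j) + (s j ∸ 1)) ≡⟨ sym (+-suc _ _) ⟩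
    Σv (s ∖ j) + suc (s j ∸ 1)   ≡⟨ cong (Σv (s ∖ j) +_) (m+[n∸m]≡n 1≤sj) ⟩
    Σv (s ∖ j) + s j             ≡⟨ Σv-update (s ∖ j) s j (λ i → ∖-other s) ⟩
    Σv s + (s ∖ j) j             ≡⟨ cong₂ _+_ Σs≡ (∖-self s j) ⟩
    suc c + (s j ∸ 1)            ∎))
  where open ≡-Reasoning

Σv-*δᶜ : ∀ (s : Fin v → ℕ) a → Σv (λ j → s j * δᶜ a j) + s a ≡ Σv s
Σv-*δᶜ s a = begin
    Σv (λ j → s j * δᶜ a j) + s a ≡⟨ Σv-update (λ j → s j * δᶜ a j) s a (λ i i≢a → *-δᶜ-≢ (s i) (i≢a ∘ sym)) ⟩
    Σv s + s a * δᶜ a a           ≡⟨ cong (Σv s +_) (*-δᶜ-refl (s a) a) ⟩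
    Σv s + 0                      ≡⟨ +-identityʳ _ ⟩
    Σv s                          ∎
  where open ≡-Reasoning

Σv-*δᶜ≡∸ : ∀ (s : Fin v → ℕ) a → Σv (λ j → s j * δᶜ a j) ≡ Σv s ∸ s a
Σv-*δᶜ≡∸ s a = trans (sym (m+n∸n≡m _ (s a))) (cong (_∸ s a) (Σv-*δᶜ s a))

+-≤-Σv : ∀ (s : Fin v → ℕ) {i j} → i ≢ j → s i + s j ≤ Σv s
+-≤-Σv s {i} {j} i≢j = begin
    s i + s j                     ≤⟨ +-monoʳ-≤ (s i) (subst (_≤ Σv (λ k → s k * δᶜ i k)) (*-δᶜ-≢ (s j) i≢j) (≤Σv _ j)) ⟩
    s i + Σv (λ k → s k * δᶜ i k) ≡⟨ trans (+-comm (s i) _) (Σv-*δᶜ s i) ⟩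
    Σv s                          ∎
  where open ≤-Reasoning

∃-otherCard : ∀ (s : Fin v → ℕ) a → s a < Σv s → ∃[ j ] (1 ≤ s j × a ≢ j)
∃-otherCard {v} s a sa<Σs
  with sum-map>0⇒∃>0 (λ j → s j * δᶜ a j) (allFin v) (subst (0 <_) (sym (Σv-*δᶜ≡∸ s a)) (m<n⇒0<n∸m sa<Σs))
... | j , 0<sj*δᶜ with a F.≟ j
...   | yes _   = ⊥-elim (n≮0 (subst (0 <_) (*-zeroʳ (s j)) 0<sj*δᶜ))
...   | no a≢j  = j , subst (0 <_) (*-identityʳ (s j)) 0<sj*δᶜ , a≢j

replicates : (Fin v → ℕ) → List (Fin v) → List (Fin v)
replicates s is = concatMap (λ i → replicate (s i) i) is

replicates-cong : ∀ {s t : Fin v → ℕ} is → All (λ i → s i ≡ t i) is → replicates s is ≡ replicates t is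
replicates-cong []       []          = refl
replicates-cong (i ∷ is) (s≡t ∷ ss≡ts) = cong₂ (λ n r → replicate n i ++ r) s≡t (replicates-cong is ss≡ts)

length-replicates : ∀ (s : Fin v → ℕ) is → length (replicates s is) ≡ sum (map s is)
length-replicates s []       = refl
length-replicates s (i ∷ is) =
  trans (length-++ (replicate (s i) i)) (cong₂ _+_ (length-replicate (s i)) (length-replicates s is))

length-multiset : ∀ (s : Fin v → ℕ) → length (multiset s) ≡ Σv s
length-multiset {v} s = length-replicates s (allFin v)

sumPicks-replicates : ∀ (s : Fin v → ℕ) (g : Fin v → List (Fin v) → ℕ) is → Unique is →
                      sumPicks g (replicates s is) ≡ sum (map (λ j → s j * g j (replicates (s ∖ j) is)) is)
sumPicks-replicates s g []       _           = refl
sumPicks-replicates s g (i ∷ is) (i∉ ∷ uniq) = begin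
    sumPicks g (replicate (s i) i ++ replicates s is)
  ≡⟨ sumPicks-++ g (replicate (s i) i) (replicates s is) ⟩
    sumPicks (λ y r → g y (r ++ replicates s is)) (replicate (s i) i)
      + sumPicks (λ y r → g y (replicate (s i) i ++ r)) (replicates s is)
  ≡⟨ cong₂ _+_ (sumPicks-replicate (λ y r → g y (r ++ replicates s is)) (s i) i)
               (sumPicks-replicates s _ is uniq) ⟩
    s i * g i (replicate (s i ∸ 1) i ++ replicates s is)
      + sum (map (λ j → s j * g j (replicate (s i) i ++ replicates (s ∖ j) is)) is)
  ≡⟨ cong₂ _+_ (cong (λ r → s i * g i r) (cong₂ (λ n r → replicate n i ++ r) (sym (∖-self s i)) rest-i))
               (cong sum (map-cong-local (All.map (λ {j} i≢j →
                 cong (λ n → s j * g j (replicate n i ++ replicates (s ∖ j) is)) (sym (∖-other s i≢j))) i∉))) ⟩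
    s i * g i (replicates (s ∖ i) (i ∷ is))
      + sum (map (λ j → s j * g j (replicates (s ∖ j) (i ∷ is))) is)
  ∎
  where
  open ≡-Reasoning
  rest-i : replicates s is ≡ replicates (s ∖ i) is
  rest-i = replicates-cong is (All.map (λ i≢j → sym (∖-other s (i≢j ∘ sym))) i∉)

-- Winning shuffles

boolToℕ : Bool → ℕ
boolToℕ true  = 1
boolToℕ false = 0

length-filterᵇ : ∀ (p : A → Bool) l → length (filterᵇ p l) ≡ sum (map (boolToℕ ∘ p) l)
length-filterᵇ p []      = refl
length-filterᵇ p (x ∷ l) with p x
... | true  = cong suc (length-filterᵇ p l)
... | false = length-filterᵇ p l

winning : List (Fin v) → (Fin v → ℕ) → ℕ
winning bs s = sumPerms (boolToℕ ∘ wins bs) (multiset s)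

Pr≡winning/! : ∀ (b s : Fin v → ℕ) → Pr b s ≡ frac (winning (bidSeq b) s) (Σv s !)
Pr≡winning/! b s = cong₂ frac (length-filterᵇ (wins (bidSeq b)) (perms (multiset s)))
                               (trans (length-perms (multiset s)) (cong _! (length-multiset s)))

winning-[] : ∀ (s : Fin v → ℕ) → winning [] s ≡ Σv s !
winning-[] s = trans (sumPerms-1 (multiset s)) (cong _! (length-multiset s))

wins-∷ : ∀ (a y : Fin v) bs τ → boolToℕ (wins (a ∷ bs) (y ∷ τ)) ≡ δᶜ a y * boolToℕ (wins bs τ)
wins-∷ a y bs τ with a F.≟ y
... | yes _ = refl
... | no _  = sym (+-identityʳ _)

-- First-step analysis: the top card has Value j in s j * winning bs (s ∖ j) of the winning shuffles, if j ≠ a.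
winning-∷ : ∀ (a : Fin v) bs s → 1 ≤ Σv s → winning (a ∷ bs) s ≡ Σv (λ j → s j * (δᶜ a j * winning bs (s ∖ j)))
winning-∷ {v} a bs s 1≤Σs = begin
    sumPerms (boolToℕ ∘ wins (a ∷ bs)) (multiset s)
  ≡⟨ byTopCard (multiset s) (subst (1 ≤_) (sym (length-multiset s)) 1≤Σs) ⟩
    sumPicks (λ y r → sumPerms (λ τ → boolToℕ (wins (a ∷ bs) (y ∷ τ))) r) (multiset s)
  ≡⟨ sumPicks-cong (λ y r → trans (cong sum (map-cong (wins-∷ a y bs) (perms r))) (sum-map-*ˡ _ (δᶜ a y) (perms r)))
                   (multiset s) ⟩
    sumPicks (λ y r → δᶜ a y * sumPerms (boolToℕ ∘ wins bs) r) (multiset s)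
  ≡⟨ sumPicks-replicates s _ (allFin v) (allFin⁺ v) ⟩
    Σv (λ j → s j * (δᶜ a j * winning bs (s ∖ j)))
  ∎
  where
  open ≡-Reasoning
  byTopCard : ∀ l → 1 ≤ length l →
              sumPerms (boolToℕ ∘ wins (a ∷ bs)) l ≡ sumPicks (λ y r → sumPerms (λ τ → boolToℕ (wins (a ∷ bs) (y ∷ τ))) r) l
  byTopCard (x ∷ xs) _ = sumPerms-∷ _ x xs

P′-suc : ∀ n k → n P′ suc k ≡ n * (pred n P′ k)
P′-suc n zero    = refl
P′-suc n (suc k) = begin
    (n ∸ suc k) * (n P′ suc k)         ≡⟨ cong₂ _*_ (sym (pred[m∸n]≡m∸[1+n] n k)) (P′-suc n k) ⟩
    pred (n ∸ k) * (n * (pred n P′ k)) ≡⟨ x∙yz≈y∙xz (pred (n ∸ k)) n _ ⟩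
    n * (pred (n ∸ k) * (pred n P′ k)) ≡⟨ cong (λ d → n * (d * (pred n P′ k))) (pred∸ n k) ⟩
    n * (pred n P′ suc k)              ∎
  where
  open ≡-Reasoning
  pred∸ : ∀ n k → pred (n ∸ k) ≡ pred n ∸ k
  pred∸ n k = trans (pred[m∸n]≡m∸[1+n] n k) (sym (∸-+-assoc n 1 k))

*-pos : ∀ {m n} → 0 < m → 0 < n → 0 < m * n
*-pos {suc m} {suc n} _ _ = s≤s z≤n

P′-pos : ∀ {n k} → k ≤ n → 0 < n P′ k
P′-pos {k = zero}  _   = s≤s z≤n
P′-pos {k = suc k} k<n = *-pos (m<n⇒0<n∸m k<n) (P′-pos (<⇒≤ k<n))

P′≡0 : ∀ {n k} → n < k → n P′ k ≡ 0
P′≡0 {n} {suc k} (s≤s n≤k) = cong (_* (n P′ k)) (m≤n⇒m∸n≡0 n≤k)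

!≡P′*! : ∀ {n k} → k ≤ n → n ! ≡ (n P′ k) * (n ∸ k) !
!≡P′*! {n} {zero}  _   = sym (*-identityˡ (n !))
!≡P′*! {n} {suc k} k<n = begin
    n !                                          ≡⟨ !≡P′*! (<⇒≤ k<n) ⟩
    (n P′ k) * (n ∸ k) !                         ≡⟨ cong (λ d → (n P′ k) * d !) n∸k≡ ⟩
    (n P′ k) * (suc (n ∸ suc k) * (n ∸ suc k) !) ≡⟨ cong (λ d → (n P′ k) * (d * (n ∸ suc k) !)) n∸k≡ ⟨
    (n P′ k) * ((n ∸ k) * (n ∸ suc k) !)         ≡⟨ x∙yz≈y∙xz (n P′ k) (n ∸ k) _ ⟩
    (n ∸ k) * ((n P′ k) * (n ∸ suc k) !)         ≡⟨ *-assoc (n ∸ k) _ _ ⟨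
    (n P′ suc k) * (n ∸ suc k) !                 ∎
  where
  open ≡-Reasoning
  n∸k≡ : n ∸ k ≡ suc (n ∸ suc k)
  n∸k≡ = +-∸-assoc 1 k<n

-- The lower bound and its equality case

-- The number of winning shuffles when all m bids name one Value with K of the c cards (winning-replicate).
lowerBound : ℕ → ℕ → ℕ → ℕ
lowerBound K c m = ((c ∸ K) P′ m) * (c ∸ m) !

lowerBound-suc : ∀ K c m → lowerBound K (suc c) (suc m) ≡ (suc c ∸ K) * lowerBound K c m
lowerBound-suc K c m = begin
    ((suc c ∸ K) P′ suc m) * (c ∸ m) !                  ≡⟨ cong (_* (c ∸ m) !) (P′-suc (suc c ∸ K) m) ⟩
    (suc c ∸ K) * (pred (suc c ∸ K) P′ m) * (c ∸ m) !   ≡⟨ *-assoc (suc c ∸ K) _ _ ⟩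
    (suc c ∸ K) * ((pred (suc c ∸ K) P′ m) * (c ∸ m) !) ≡⟨ cong (λ d → (suc c ∸ K) * ((d P′ m) * (c ∸ m) !))
                                                                (pred[m∸n]≡m∸[1+n] (suc c) K) ⟩
    (suc c ∸ K) * lowerBound K c m                      ∎
  where open ≡-Reasoning

lowerBound-empty : ∀ K m → lowerBound K 0 (suc m) ≡ 0
lowerBound-empty K m = cong (_* (0 ∸ suc m) !) (P′≡0 {k = suc m} (s≤s (≤-trans (m∸n≤m 0 K) z≤n)))

lowerBound-pos : ∀ K c m → m ≤ c ∸ K → 0 < lowerBound K c m
lowerBound-pos K c m m≤c∸K = *-pos (P′-pos m≤c∸K) (1≤n! (c ∸ m))

Σv-weighted : ∀ (s : Fin v → ℕ) a L → Σv (λ j → s j * (δᶜ a j * L)) ≡ (Σv s ∸ s a) * L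
Σv-weighted {v} s a L = begin
    Σv (λ j → s j * (δᶜ a j * L))                 ≡⟨ cong sum (map-cong (λ j → sym (*-assoc (s j) _ _)) (allFin v)) ⟩
    sum (map (λ j → s j * δᶜ a j * L) (allFin v)) ≡⟨ sum-map-*ʳ _ L (allFin v) ⟩
    Σv (λ j → s j * δᶜ a j) * L                   ≡⟨ cong (_* L) (Σv-*δᶜ≡∸ s a) ⟩
    (Σv s ∸ s a) * L                              ∎
  where open ≡-Reasoning

weighted-≤ : ∀ (s : Fin v → ℕ) a {f g : Fin v → ℕ} → (∀ j → 1 ≤ s j → a ≢ j → f j ≤ g j) →
             ∀ j → s j * (δᶜ a j * f j) ≤ s j * (δᶜ a j * g j)
weighted-≤ s a f≤g j with a F.≟ j | s j in sj≡
... | yes _   | _     = ≤-refl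
... | no _    | zero  = z≤n
... | no a≢j  | suc t = *-monoʳ-≤ (suc t) (*-monoʳ-≤ 1 (f≤g j (subst (1 ≤_) (sym sj≡) (s≤s z≤n)) a≢j))

module _ (a : Fin v) (bs : List (Fin v)) (s : Fin v → ℕ) {c L : ℕ} (Σs≡ : Σv s ≡ suc c) where

  private
    expand : winning (a ∷ bs) s ≡ Σv (λ j → s j * (δᶜ a j * winning bs (s ∖ j)))
    expand = winning-∷ a bs s (subst (1 ≤_) (sym Σs≡) (s≤s z≤n))

    weighted : ∀ n → Σv (λ j → s j * (δᶜ a j * n)) ≡ (suc c ∸ s a) * n
    weighted n = trans (Σv-weighted s a n) (cong (λ d → (d ∸ s a) * n) Σs≡)

  winning-∷-≥ : (∀ j → 1 ≤ s j → a ≢ j → L ≤ winning bs (s ∖ j)) → (suc c ∸ s a) * L ≤ winning (a ∷ bs) s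
  winning-∷-≥ L≤ = begin
      (suc c ∸ s a) * L                              ≡⟨ weighted L ⟨
      Σv (λ j → s j * (δᶜ a j * L))                  ≤⟨ sum-map-mono (weighted-≤ s a L≤) (allFin v) ⟩
      Σv (λ j → s j * (δᶜ a j * winning bs (s ∖ j))) ≡⟨ expand ⟨
      winning (a ∷ bs) s                             ∎
    where open ≤-Reasoning

  winning-∷-≤ : (∀ j → 1 ≤ s j → a ≢ j → winning bs (s ∖ j) ≤ L) → winning (a ∷ bs) s ≤ (suc c ∸ s a) * L
  winning-∷-≤ ≤L = begin
      winning (a ∷ bs) s                             ≡⟨ expand ⟩
      Σv (λ j → s j * (δᶜ a j * winning bs (s ∖ j))) ≤⟨ sum-map-mono (weighted-≤ s a ≤L) (allFin v) ⟩
      Σv (λ j → s j * (δᶜ a j * L))                  ≡⟨ weighted L ⟩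
      (suc c ∸ s a) * L                              ∎
    where open ≤-Reasoning

  winning-∷-tight : (∀ j → 1 ≤ s j → a ≢ j → L ≤ winning bs (s ∖ j)) →
                    winning (a ∷ bs) s ≤ (suc c ∸ s a) * L → ∀ j → 1 ≤ s j → a ≢ j → winning bs (s ∖ j) ≤ L
  winning-∷-tight L≤ W≤ j 1≤sj a≢j = *-cancelˡ-≤ (s j) {{>-nonZero 1≤sj}} (subst₂ _≤_
      (cong (s j *_) (δᶜ-*-≢ (winning bs (s ∖ j)) a≢j)) (cong (s j *_) (δᶜ-*-≢ L a≢j))
      (All.lookup termwise (∈-allFin j)))
    where
    termwise : All (λ j → s j * (δᶜ a j * winning bs (s ∖ j)) ≤ s j * (δᶜ a j * L)) (allFin v)
    termwise = sum-map-mono-tight (weighted-≤ s a L≤) (allFin v)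
      (≤-trans (≤-reflexive (sym expand)) (≤-trans W≤ (≤-reflexive (sym (weighted L)))))

winning-≥ : ∀ bs (s : Fin v → ℕ) {K c} → (∀ j → s j ≤ K) → Σv s ≡ c →
            lowerBound K c (length bs) ≤ winning bs s
winning-≥ []       s               _   refl = ≤-reflexive (trans (*-identityˡ _) (sym (winning-[] s)))
winning-≥ (a ∷ bs) s {K} {zero}  _   _    = subst (_≤ winning (a ∷ bs) s) (sym (lowerBound-empty K (length bs))) z≤n
winning-≥ (a ∷ bs) s {K} {suc c} s≤K Σs≡  = begin
    lowerBound K (suc c) (suc (length bs))     ≡⟨ lowerBound-suc K c (length bs) ⟩
    (suc c ∸ K) * lowerBound K c (length bs)   ≤⟨ *-monoˡ-≤ _ (∸-monoʳ-≤ (suc c) (s≤K a)) ⟩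
    (suc c ∸ s a) * lowerBound K c (length bs) ≤⟨ winning-∷-≥ a bs s Σs≡ (λ j 1≤sj _ →
                                                  winning-≥ bs (s ∖ j) (∖-≤-bound s≤K j) (Σv-∖ s Σs≡ 1≤sj)) ⟩
    winning (a ∷ bs) s                         ∎
  where open ≤-Reasoning

winning-replicate : ∀ m j (s : Fin v → ℕ) {c} → Σv s ≡ c → m ≤ c → winning (replicate m j) s ≡ lowerBound (s j) c m
winning-replicate zero    j s         refl _           = trans (winning-[] s) (sym (*-identityˡ _))
winning-replicate (suc m) j s {suc c} Σs≡  (s≤s m≤c) = ≤-antisym
  (≤-trans (winning-∷-≤ j _ s Σs≡ (λ k 1≤sk j≢k → ≤-reflexive (afterDraw k 1≤sk j≢k))) (≤-reflexive bound≡))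
  (≤-trans (≤-reflexive (sym bound≡))
           (winning-∷-≥ j _ s Σs≡ (λ k 1≤sk j≢k → ≤-reflexive (sym (afterDraw k 1≤sk j≢k)))))
  where
  afterDraw : ∀ k → 1 ≤ s k → j ≢ k → winning (replicate m j) (s ∖ k) ≡ lowerBound (s j) c m
  afterDraw k 1≤sk j≢k = trans (winning-replicate m j (s ∖ k) (Σv-∖ s Σs≡ 1≤sk) m≤c)
                               (cong (λ d → lowerBound d c m) (∖-other s j≢k))
  bound≡ : (suc c ∸ s j) * lowerBound (s j) c m ≡ lowerBound (s j) (suc c) (suc m)
  bound≡ = sym (lowerBound-suc (s j) c m)

suc[m]≤suc[c]∸k⇒m≤c∸k : ∀ {m} c k → suc m ≤ suc c ∸ k → m ≤ c ∸ k
suc[m]≤suc[c]∸k⇒m≤c∸k {m} c k m< = subst (m ≤_) (pred[m∸n]≡m∸[1+n] (suc c) k) (suc[m]≤n⇒m≤pred[n] m<)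

winning-∷-attains : ∀ a bs (s : Fin v → ℕ) {K c} → (∀ j → s j ≤ K) → Σv s ≡ suc c →
                    suc (length bs) ≤ suc c ∸ K → winning (a ∷ bs) s ≤ lowerBound K (suc c) (suc (length bs)) →
                    s a ≡ K × (∀ j → 1 ≤ s j → a ≢ j → winning bs (s ∖ j) ≤ lowerBound K c (length bs))
winning-∷-attains a bs s {K} {c} s≤K Σs≡ m< W≤ =
  sa≡K , winning-∷-tight a bs s Σs≡ L≤ (subst (λ x → winning (a ∷ bs) s ≤ (suc c ∸ x) * L) (sym sa≡K) W≤′)
  where
  L : ℕ
  L = lowerBound K c (length bs)
  L≤ : ∀ j → 1 ≤ s j → a ≢ j → L ≤ winning bs (s ∖ j)
  L≤ j 1≤sj _ = winning-≥ bs (s ∖ j) (∖-≤-bound s≤K j) (Σv-∖ s Σs≡ 1≤sj)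
  W≤′ : winning (a ∷ bs) s ≤ (suc c ∸ K) * L
  W≤′ = subst (winning (a ∷ bs) s ≤_) (lowerBound-suc K c (length bs)) W≤
  K≤sa : K ≤ s a
  K≤sa = ∸-cancelʳ-≤ (<⇒≤ (m∸n≢0⇒n<m (m<n⇒n≢0 m<)))
           (*-cancelʳ-≤ _ _ L {{>-nonZero (lowerBound-pos K c _ (suc[m]≤suc[c]∸k⇒m≤c∸k c K m<))}}
             (≤-trans (winning-∷-≥ a bs s Σs≡ L≤) W≤′))
  sa≡K : s a ≡ K
  sa≡K = ≤-antisym (s≤K a) K≤sa

-- After a first draw j ≠ a the bound stays attained, so by induction every such deck s ∖ j has K cards of the
-- next bid a′; if a′ ≠ a, drawing j = a′ itself would leave only s a′ ∸ 1 < K of them.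
winning-attains⇒ : ∀ a bs (s : Fin v → ℕ) {K c} → (∀ j → s j ≤ K) → Σv s ≡ c →
                   suc (length bs) ≤ c ∸ K → winning (a ∷ bs) s ≤ lowerBound K c (suc (length bs)) →
                   s a ≡ K × All (_≡ a) bs
winning-attains⇒ a bs        s {K} {zero}  _   _   m< _  = ⊥-elim (n≮0 (subst (length bs <_) (0∸n≡0 K) m<))
winning-attains⇒ a []        s {K} {suc c} s≤K Σs≡ m< W≤ = proj₁ (winning-∷-attains a [] s s≤K Σs≡ m< W≤) , []
winning-attains⇒ a (a′ ∷ bs) s {K} {suc c} s≤K Σs≡ m< W≤ = sa≡K , all≡a
  where
  attains : s a ≡ K × (∀ j → 1 ≤ s j → a ≢ j → winning (a′ ∷ bs) (s ∖ j) ≤ lowerBound K c (suc (length bs)))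
  attains = winning-∷-attains a (a′ ∷ bs) s s≤K Σs≡ m< W≤
  sa≡K : s a ≡ K
  sa≡K = proj₁ attains
  afterDraw : ∀ j → 1 ≤ s j → a ≢ j → (s ∖ j) a′ ≡ K × All (_≡ a′) bs
  afterDraw j 1≤sj a≢j = winning-attains⇒ a′ bs (s ∖ j) (∖-≤-bound s≤K j) (Σv-∖ s Σs≡ 1≤sj)
                           (suc[m]≤suc[c]∸k⇒m≤c∸k c K m<) (proj₂ attains j 1≤sj a≢j)
  other : ∃[ j ] (1 ≤ s j × a ≢ j)
  other = ∃-otherCard s a (subst₂ _<_ (sym sa≡K) (sym Σs≡) (m∸n≢0⇒n<m (m<n⇒n≢0 m<)))
  all≡a : All (_≡ a) (a′ ∷ bs)
  all≡a with other
  ... | j₀ , 1≤sj₀ , a≢j₀ with afterDraw j₀ 1≤sj₀ a≢j₀ | a′ F.≟ a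
  ...   | _ , bs≡a′ | yes a′≡a = a′≡a ∷ All.map (λ x≡a′ → trans x≡a′ a′≡a) bs≡a′
  ...   | sa′≡K , _ | no a′≢a  = ⊥-elim (<-irrefl refl (begin-strict
      s a′            ≤⟨ s≤K a′ ⟩
      K               ≡⟨ trans (sym (proj₁ (afterDraw a′ 1≤sa′ (a′≢a ∘ sym)))) (∖-self s a′) ⟩
      s a′ ∸ 1        <⟨ ∸-monoʳ-< (s≤s z≤n) 1≤sa′ ⟩
      s a′            ∎))
    where
    open ≤-Reasoning
    1≤sa′ : 1 ≤ s a′
    1≤sa′ = ≤-trans 1≤sj₀ (≤-trans (s≤K j₀) (≤-trans (≤-reflexive (sym sa′≡K)) (∖-≤ s j₀ a′)))

-- Bids that can win

count : Fin v → List (Fin v) → ℕ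
count i l = sum (map (δ i) l)

δ≤1 : ∀ (i j : Fin v) → δ i j ≤ 1
δ≤1 i j with i F.≟ j
... | yes _ = ≤-refl
... | no _  = z≤n

δ+δ≤1 : ∀ {i i′ : Fin v} → i ≢ i′ → ∀ j → δ i j + δ i′ j ≤ 1
δ+δ≤1 {i = i} {i′} i≢i′ j with i F.≟ j | i′ F.≟ j
... | yes i≡j | yes i′≡j = ⊥-elim (i≢i′ (trans i≡j (sym i′≡j)))
... | yes _   | no _     = ≤-refl
... | no _    | yes _    = ≤-refl
... | no _    | no _     = z≤n

count≤length : ∀ (i : Fin v) l → count i l ≤ length l
count≤length i l = subst (count i l ≤_) (sym (length≡sum-map-1 l)) (sum-map-mono (δ≤1 i) l)

count+count≤length : ∀ {i i′ : Fin v} → i ≢ i′ → ∀ l → count i l + count i′ l ≤ length l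
count+count≤length {i = i} {i′} i≢i′ l = begin
    count i l + count i′ l              ≡⟨ sum-map-+ (δ i) (δ i′) l ⟨
    sum (map (λ j → δ i j + δ i′ j) l) ≤⟨ sum-map-mono (δ+δ≤1 i≢i′) l ⟩
    sum (map (const 1) l)              ≡⟨ length≡sum-map-1 l ⟨
    length l                           ∎
  where open ≤-Reasoning

count-All≡ : ∀ (i a : Fin v) {l} → All (_≡ a) l → count i l ≡ length l * δ i a
count-All≡ i a []             = refl
count-All≡ i a (refl ∷ l≡a) = cong (δ i a +_) (count-All≡ i a l≡a)

count-multiset : ∀ (b : Fin v → ℕ) i → count i (multiset b) ≡ b i
count-multiset {v} b i = begin
    count i (multiset b)                 ≡⟨ sum-map-concatMap (δ i) (λ k → replicate (b k) k) (allFin v) ⟩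
    Σv (λ k → count i (replicate (b k) k)) ≡⟨ cong sum (map-cong (λ k → sum-map-replicate (δ i) (b k) k) (allFin v)) ⟩
    Σv (λ k → b k * δ i k)               ≡⟨ +-identityʳ _ ⟨
    Σv (λ k → b k * δ i k) + 0           ≡⟨ Σv-update (λ k → b k * δ i k) (const 0) i (λ k k≢i → *-δ-≢ (b k) (k≢i ∘ sym)) ⟩
    Σv {v} (const 0) + b i * δ i i       ≡⟨ cong₂ _+_ (sum-map-zero (λ _ → refl) (allFin v)) (*-δ-refl (b i) i) ⟩
    b i                                  ∎
  where open ≡-Reasoning

-- The s i cards of Value i must avoid the count i bs rounds naming i.
winning≡0 : ∀ bs (s : Fin v → ℕ) {c} i → Σv s ≡ c → length bs ≤ c → c < count i bs + s i → winning bs s ≡ 0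
winning≡0 []       s         i refl _ c< = ⊥-elim (<⇒≱ c< (≤Σv s i))
winning≡0 (a ∷ bs) s {suc c} i Σs≡ (s≤s len≤) c< =
  n≤0⇒n≡0 (subst (winning (a ∷ bs) s ≤_) (*-zeroʳ (suc c ∸ s a))
    (winning-∷-≤ a bs s Σs≡ (λ j 1≤sj a≢j →
      ≤-reflexive (winning≡0 bs (s ∖ j) i (Σv-∖ s Σs≡ 1≤sj) len≤ (afterDraw j 1≤sj a≢j)))))
  where
  afterDraw : ∀ j → 1 ≤ s j → a ≢ j → c < count i bs + (s ∖ j) i
  afterDraw j 1≤sj a≢j with i F.≟ j
  ... | yes refl = s≤s⁻¹ (begin-strict
      suc c                              <⟨ c< ⟩
      δ i a + count i bs + s i           ≡⟨ cong (λ d → d + count i bs + s i) (δ-≢ (a≢j ∘ sym)) ⟩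
      count i bs + s i                   ≡⟨ cong (count i bs +_) (sym (m+[n∸m]≡n 1≤sj)) ⟩
      count i bs + suc (s i ∸ 1)         ≡⟨ +-suc (count i bs) _ ⟩
      suc (count i bs + (s i ∸ 1))       ∎)
    where open ≤-Reasoning
  ... | no _ = s≤s⁻¹ (begin-strict
      suc c                              <⟨ c< ⟩
      δ i a + count i bs + s i           ≤⟨ +-monoˡ-≤ (s i) (+-monoˡ-≤ (count i bs) (δ≤1 i a)) ⟩
      suc (count i bs + s i)             ∎)
    where open ≤-Reasoning

tight-unique : ∀ (s : Fin v → ℕ) {c l i i′} → Σv s ≡ suc c → length l ≤ c → i ≢ i′ →
               c < count i l + s i → c < count i′ l + s i′ → ⊥
tight-unique s {c} {l} {i} {i′} Σs≡ len≤ i≢i′ c<i c<i′ = 1+n≰n (+-cancelʳ-≤ (suc c) (suc c) c (begin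
    suc c + suc c                           ≤⟨ +-mono-≤ c<i c<i′ ⟩
    (count i l + s i) + (count i′ l + s i′) ≡⟨ interchange (count i l) (s i) _ _ ⟩
    (count i l + count i′ l) + (s i + s i′) ≤⟨ +-mono-≤ (≤-trans (count+count≤length i≢i′ l) len≤)
                                                       (subst (s i + s i′ ≤_) Σs≡ (+-≤-Σv s i≢i′)) ⟩
    c + suc c                               ∎))
  where open ≤-Reasoning

-- A Value with no room to spare must be drawn now, and by tight-unique there is at most one such Value.
∃-drawKeepingRoom : ∀ a bs (s : Fin v → ℕ) {c} → Σv s ≡ suc c → length bs ≤ c →
                    (∀ i → count i (a ∷ bs) + s i ≤ suc c) →
                    ∃[ j ] (1 ≤ s j × a ≢ j × (∀ i → count i bs + (s ∖ j) i ≤ c))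
∃-drawKeepingRoom a bs s {c} Σs≡ len≤ room = choose (any? (λ i → c <? count i bs + s i))
  where
  roomSelf : count a bs + s a ≤ c
  roomSelf = s≤s⁻¹ (subst (λ d → d + count a bs + s a ≤ suc c) (δ-refl a) (room a))
  roomAfterDraw : ∀ {j} → 1 ≤ s j → a ≢ j → (∀ i → i ≢ j → count i bs + s i ≤ c) →
                  ∀ i → count i bs + (s ∖ j) i ≤ c
  roomAfterDraw {j} 1≤sj a≢j room≢j i with i F.≟ j
  ... | yes refl = s≤s⁻¹ (begin
      suc (count i bs + (s i ∸ 1)) ≡⟨ +-suc _ _ ⟨
      count i bs + suc (s i ∸ 1)   ≡⟨ cong (count i bs +_) (m+[n∸m]≡n 1≤sj) ⟩
      count i bs + s i             ≡⟨ cong (λ d → d + count i bs + s i) (δ-≢ (a≢j ∘ sym)) ⟨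
      δ i a + count i bs + s i     ≤⟨ room i ⟩
      suc c                        ∎)
    where open ≤-Reasoning
  ... | no i≢j = room≢j i i≢j
  choose : Dec (∃[ i ] c < count i bs + s i) → ∃[ j ] (1 ≤ s j × a ≢ j × (∀ i → count i bs + (s ∖ j) i ≤ c))
  choose (yes (i , c<)) = i , 1≤si , a≢i ,
      roomAfterDraw 1≤si a≢i (λ i′ i′≢i → ≮⇒≥ (λ c<′ → tight-unique s {l = bs} Σs≡ len≤ i′≢i c<′ c<))
    where
    a≢i : a ≢ i
    a≢i refl = <⇒≱ c< roomSelf
    1≤si : 1 ≤ s i
    1≤si = n≢0⇒n>0 (λ si≡0 → <⇒≱ c< (≤-trans (≤-reflexive (trans (cong (count i bs +_) si≡0) (+-identityʳ _)))
                                               (≤-trans (count≤length i bs) len≤)))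
  choose (no ¬tight) with ∃-otherCard s a (subst (s a <_) (sym Σs≡) (s≤s (≤-trans (m≤n+m (s a) _) roomSelf)))
  ... | j , 1≤sj , a≢j = j , 1≤sj , a≢j , roomAfterDraw 1≤sj a≢j (λ i _ → ≮⇒≥ (λ c< → ¬tight (i , c<)))

winning>0 : ∀ bs (s : Fin v → ℕ) {c} → Σv s ≡ c → length bs ≤ c → (∀ i → count i bs + s i ≤ c) →
            0 < winning bs s
winning>0 []       s         refl _           _    = subst (0 <_) (sym (winning-[] s)) (1≤n! (Σv s))
winning>0 (a ∷ bs) s {suc c} Σs≡  (s≤s len≤) room with ∃-drawKeepingRoom a bs s Σs≡ len≤ room
... | j , 1≤sj , a≢j , room′ = begin-strict
    0                                              <⟨ *-pos 1≤sj (subst (0 <_) (sym (δᶜ-*-≢ _ a≢j))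
                                                                        (winning>0 bs (s ∖ j) (Σv-∖ s Σs≡ 1≤sj) len≤ room′)) ⟩
    s j * (δᶜ a j * winning bs (s ∖ j))            ≤⟨ ∈⇒≤sum-map _ (∈-allFin j) ⟩
    Σv (λ k → s k * (δᶜ a k * winning bs (s ∖ k))) ≡⟨ winning-∷ a bs s (subst (1 ≤_) (sym Σs≡) (s≤s z≤n)) ⟨
    winning (a ∷ bs) s                             ∎
  where open ≤-Reasoning

private
  toℚᵘ-frac : ∀ a d → toℚᵘ (frac a (suc d)) ℚᵘ.≃ mkℚᵘ (ℤ.+ a) d
  toℚᵘ-frac a d = toℚᵘ-fromℚᵘ (mkℚᵘ (ℤ.+ a) d)

frac-≤ : ∀ {a b d e} → 0 < d → 0 < e → a * e ≤ b * d → frac a d ℚ.≤ frac b e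
frac-≤ {a} {b} {suc d} {suc e} _ _ ae≤bd = toℚᵘ-cancel-≤
  (ℚᵘ.≤-respˡ-≃ (ℚᵘ.≃-sym (toℚᵘ-frac a d)) (ℚᵘ.≤-respʳ-≃ (ℚᵘ.≃-sym (toℚᵘ-frac b e))
    (*≤* (subst₂ ℤ._≤_ (ℤ.pos-* a (suc e)) (ℤ.pos-* b (suc d)) (ℤ.+≤+ ae≤bd)))))

frac-cong : ∀ {a b d e} → 0 < d → 0 < e → a * e ≡ b * d → frac a d ≡ frac b e
frac-cong {a} {b} {suc d} {suc e} _ _ ae≡bd = toℚᵘ-injective (ℚᵘ.≃-trans (toℚᵘ-frac a d)
  (ℚᵘ.≃-trans (*≡* (trans (sym (ℤ.pos-* a (suc e))) (trans (cong ℤ.+_ ae≡bd) (ℤ.pos-* b (suc d)))))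
              (ℚᵘ.≃-sym (toℚᵘ-frac b e))))

frac-injective : ∀ {a b d e} → 0 < d → 0 < e → frac a d ≡ frac b e → a * e ≡ b * d
frac-injective {a} {b} {suc d} {suc e} _ _ eq
  with ℚᵘ.≃-trans (ℚᵘ.≃-sym (toℚᵘ-frac a d)) (ℚᵘ.≃-trans (ℚᵘ.≃-reflexive (cong toℚᵘ eq)) (toℚᵘ-frac b e))
... | *≡* ae≡bd = ℤ.+-injective (trans (ℤ.pos-* a (suc e)) (trans ae≡bd (sym (ℤ.pos-* b (suc d)))))

frac-* : ∀ {a b d e} → 0 < d → 0 < e → frac a d ℚ.* frac b e ≡ frac (a * b) (d * e)
frac-* {a} {b} {suc d} {suc e} _ _ = toℚᵘ-injective (ℚᵘ.≃-trans (toℚᵘ-homo-* (frac a (suc d)) (frac b (suc e)))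
  (ℚᵘ.≃-trans (ℚᵘ.*-cong (toℚᵘ-frac a d) (toℚᵘ-frac b e))
  (ℚᵘ.≃-trans (ℚᵘ.≃-reflexive (cong (λ n → mkℚᵘ n _) (sym (ℤ.pos-* a b)))) (ℚᵘ.≃-sym (toℚᵘ-frac (a * b) _)))))

frac-monoˡ-≤ : ∀ {a b d} → 0 < d → a ≤ b → frac a d ℚ.≤ frac b d
frac-monoˡ-≤ {d = d} 0<d a≤b = frac-≤ 0<d 0<d (*-monoˡ-≤ d a≤b)

frac-injectiveˡ : ∀ {a b d} → 0 < d → frac a d ≡ frac b d → a ≡ b
frac-injectiveˡ {d = d} 0<d eq = *-cancelʳ-≡ _ _ d {{>-nonZero 0<d}} (frac-injective 0<d 0<d eq)

0≤frac : ∀ a {d} → 0 < d → 0ℚ ℚ.≤ frac a d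
0≤frac a {d} 0<d = frac-≤ {0} {a} {1} {d} (s≤s z≤n) 0<d z≤n

frac≡0⇔ : ∀ {a d} → 0 < d → (frac a d ≡ 0ℚ ⇔ a ≡ 0)
frac≡0⇔ {a} {d} 0<d = mk⇔ (λ eq → trans (sym (*-identityʳ a)) (frac-injective {a} {0} {d} {1} 0<d (s≤s z≤n) eq))
                           (λ { refl → frac-cong {0} {0} {d} {1} 0<d (s≤s z≤n) refl })

prodℚ-frac : ∀ x {c} m → m ≤ c → prodℚ m (λ i → frac (x ∸ i) (c ∸ i)) ≡ frac (x P′ m) (c P′ m)
prodℚ-frac x zero    _   = refl
prodℚ-frac x {c} (suc m) m<c = begin
    prodℚ m (λ i → frac (x ∸ i) (c ∸ i)) ℚ.* frac (x ∸ m) (c ∸ m) ≡⟨ cong (ℚ._* frac (x ∸ m) (c ∸ m)) (prodℚ-frac x m (<⇒≤ m<c)) ⟩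
    frac (x P′ m) (c P′ m) ℚ.* frac (x ∸ m) (c ∸ m)              ≡⟨ frac-* (P′-pos (<⇒≤ m<c)) (m<n⇒0<n∸m m<c) ⟩
    frac ((x P′ m) * (x ∸ m)) ((c P′ m) * (c ∸ m))               ≡⟨ cong₂ frac (*-comm (x P′ m) _) (*-comm (c P′ m) _) ⟩
    frac (x P′ suc m) (c P′ suc m)                               ∎
  where open ≡-Reasoning

replicates-zero : ∀ {b : Fin v → ℕ} is → All (λ i → b i ≡ 0) is → replicates b is ≡ []
replicates-zero []       []            = refl
replicates-zero (i ∷ is) (bi≡0 ∷ b≡0) rewrite bi≡0 = replicates-zero is b≡0

replicates-single : ∀ (b : Fin v → ℕ) {j is} → Unique is → j ∈ is → (∀ i → i ≢ j → b i ≡ 0) →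
                    replicates b is ≡ replicate (b j) j
replicates-single b {is = i ∷ is} (i∉ ∷ _) (here refl) b≡0 =
  trans (cong (replicate (b i) i ++_) (replicates-zero is (All.map (λ i≢k → b≡0 _ (i≢k ∘ sym)) i∉))) (++-identityʳ _)
replicates-single b {is = i ∷ is} (i∉ ∷ uniq) (there j∈) b≡0 rewrite b≡0 i (All.lookup i∉ j∈) =
  replicates-single b uniq j∈ b≡0

multiset-single : ∀ (b : Fin v → ℕ) j → (∀ i → i ≢ j → b i ≡ 0) → multiset b ≡ replicate (b j) j
multiset-single {v} b j = replicates-single b (allFin⁺ v) (∈-allFin j)

All≡⇒single : ∀ (b : Fin v → ℕ) j → All (_≡ j) (multiset b) → b j ≡ Σv b × (∀ i → i ≢ j → b i ≡ 0)
All≡⇒single b j bids≡j = trans (bᵢ≡ j) (*-δ-refl (Σv b) j) , λ i i≢j → trans (bᵢ≡ i) (*-δ-≢ (Σv b) i≢j)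
  where
  bᵢ≡ : ∀ i → b i ≡ Σv b * δ i j
  bᵢ≡ i = trans (sym (count-multiset b i)) (trans (count-All≡ i j bids≡j) (cong (_* δ i j) (length-multiset b)))

alwaysBid : Fin v → ℕ → Fin v → ℕ
alwaysBid j m i = m * δ i j

Σv-alwaysBid : ∀ (j : Fin v) m → Σv (alwaysBid j m) ≡ m
Σv-alwaysBid {v} j m = begin
    Σv (alwaysBid j m)               ≡⟨ +-identityʳ _ ⟨
    Σv (alwaysBid j m) + 0           ≡⟨ Σv-update (alwaysBid j m) (const 0) j (λ i → *-δ-≢ m) ⟩
    Σv {v} (const 0) + alwaysBid j m j ≡⟨ cong₂ _+_ (sum-map-zero (λ _ → refl) (allFin v)) (*-δ-refl m j) ⟩
    m                                ∎
  where open ≡-Reasoning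

-- The winning probability of always naming a Value with K of the c cards (Pr-single).
Pr-bound : ℕ → ℕ → ℕ → ℚ
Pr-bound K c m = prodℚ m (λ i → frac (c ∸ K ∸ i) (c ∸ i))

Pr-bound≡ : ∀ K {c m} → m ≤ c → Pr-bound K c m ≡ frac (lowerBound K c m) (c !)
Pr-bound≡ K {c} {m} m≤c = trans (prodℚ-frac (c ∸ K) m m≤c) (frac-cong (P′-pos m≤c) (1≤n! c) (begin
    ((c ∸ K) P′ m) * c !                       ≡⟨ cong (((c ∸ K) P′ m) *_) (!≡P′*! m≤c) ⟩
    ((c ∸ K) P′ m) * ((c P′ m) * (c ∸ m) !)    ≡⟨ x∙yz≈xz∙y ((c ∸ K) P′ m) _ _ ⟩
    lowerBound K c m * (c P′ m)                ∎))
  where open ≡-Reasoning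

0≤Pr : ∀ (b s : Fin v → ℕ) → 0ℚ ℚ.≤ Pr b s
0≤Pr b s = subst (0ℚ ℚ.≤_) (sym (Pr≡winning/! b s)) (0≤frac _ (1≤n! (Σv s)))

Pr≥bound : ∀ (s : Fin v → ℕ) {K m} b → (∀ j → s j ≤ K) → Σv b ≡ m → m ≤ Σv s →
           Pr-bound K (Σv s) m ℚ.≤ Pr b s
Pr≥bound s {K} b s≤K refl m≤c = subst₂ ℚ._≤_ (sym (Pr-bound≡ K m≤c)) (sym (Pr≡winning/! b s))
  (frac-monoˡ-≤ (1≤n! (Σv s)) (subst (λ n → lowerBound K (Σv s) n ≤ winning (bidSeq b) s) (length-multiset b)
                                    (winning-≥ (bidSeq b) s s≤K refl)))

Pr-single : ∀ (s b : Fin v → ℕ) {K m} j → s j ≡ K → b j ≡ m → (∀ i → i ≢ j → b i ≡ 0) → m ≤ Σv s →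
            Pr b s ≡ Pr-bound K (Σv s) m
Pr-single s b j refl refl b≡0 m≤c = begin
    Pr b s                                          ≡⟨ Pr≡winning/! b s ⟩
    frac (winning (bidSeq b) s) (Σv s !)            ≡⟨ cong (λ bs → frac (winning bs s) (Σv s !)) (multiset-single b j b≡0) ⟩
    frac (winning (replicate (b j) j) s) (Σv s !)   ≡⟨ cong (λ n → frac n (Σv s !)) (winning-replicate (b j) j s refl m≤c) ⟩
    frac (lowerBound (s j) (Σv s) (b j)) (Σv s !)   ≡⟨ Pr-bound≡ (s j) m≤c ⟨
    Pr-bound (s j) (Σv s) (b j)                     ∎
  where open ≡-Reasoning

winning≡lowerBound⇒ : ∀ bs (s : Fin v → ℕ) k → (∀ j → s j ≤ s k) → length bs ≤ Σv s ∸ s k →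
                      winning bs s ≡ lowerBound (s k) (Σv s) (length bs) → ∃[ j ] (s j ≡ s k × All (_≡ j) bs)
winning≡lowerBound⇒ []       s k _    _    _  = k , refl , []
winning≡lowerBound⇒ (a ∷ bs) s k s≤sk len≤ W≡ with winning-attains⇒ a bs s s≤sk refl len≤ (≤-reflexive W≡)
... | sa≡sk , bs≡a = a , sa≡sk , refl ∷ bs≡a

Pr≡bound⇒winning≡ : ∀ (s b : Fin v → ℕ) {K} → Σv b ≤ Σv s → Pr b s ≡ Pr-bound K (Σv s) (Σv b) →
                    winning (bidSeq b) s ≡ lowerBound K (Σv s) (length (bidSeq b))
Pr≡bound⇒winning≡ s b {K} m≤c Pr≡ = begin
    winning (bidSeq b) s                    ≡⟨ frac-injectiveˡ (1≤n! (Σv s)) (trans (sym (Pr≡winning/! b s)) (trans Pr≡ (Pr-bound≡ K m≤c))) ⟩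
    lowerBound K (Σv s) (Σv b)              ≡⟨ cong (lowerBound K (Σv s)) (length-multiset b) ⟨
    lowerBound K (Σv s) (length (bidSeq b)) ∎
  where open ≡-Reasoning

Pr≡bound⇒single : ∀ (s : Fin v → ℕ) k {m} b → (∀ j → s j ≤ s k) → Σv b ≡ m → m ≤ Σv s ∸ s k →
                  Pr b s ≡ Pr-bound (s k) (Σv s) m → ∃[ j ] (s j ≡ s k × b j ≡ m × (∀ i → i ≢ j → b i ≡ 0))
Pr≡bound⇒single s k b s≤sk refl m≤ Pr≡
  with winning≡lowerBound⇒ (bidSeq b) s k s≤sk (subst (_≤ Σv s ∸ s k) (sym (length-multiset b)) m≤)
         (Pr≡bound⇒winning≡ s b {s k} (≤-trans m≤ (m∸n≤m (Σv s) (s k))) Pr≡)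
... | j , sj≡sk , bids≡j = j , sj≡sk , All≡⇒single b j bids≡j

Pr≡0⇔ : ∀ (s b : Fin v → ℕ) {m} → Σv b ≡ m → m ≤ Σv s → (Pr b s ≡ 0ℚ ⇔ (∃[ i ] (Σv s ∸ s i < b i)))
Pr≡0⇔ s b refl m≤c = mk⇔ to from
  where
  len≤ : length (bidSeq b) ≤ Σv s
  len≤ = subst (_≤ Σv s) (sym (length-multiset b)) m≤c
  W≡0⇔ : Pr b s ≡ 0ℚ ⇔ winning (bidSeq b) s ≡ 0
  W≡0⇔ = subst (λ q → q ≡ 0ℚ ⇔ winning (bidSeq b) s ≡ 0) (sym (Pr≡winning/! b s)) (frac≡0⇔ (1≤n! (Σv s)))
  to : Pr b s ≡ 0ℚ → ∃[ i ] (Σv s ∸ s i < b i)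
  to Pr≡0 with any? (λ i → Σv s ∸ s i <? b i)
  ... | yes found = found
  ... | no none   = ⊥-elim (<⇒≢ (winning>0 (bidSeq b) s refl len≤ room) (sym (Equivalence.to W≡0⇔ Pr≡0)))
    where
    room : ∀ i → count i (bidSeq b) + s i ≤ Σv s
    room i = subst (λ n → n + s i ≤ Σv s) (sym (count-multiset b i))
                   (m≤o∸n⇒m+n≤o (b i) (≤Σv s i) (≮⇒≥ (λ lt → none (i , lt))))
  from : ∃[ i ] (Σv s ∸ s i < b i) → Pr b s ≡ 0ℚ
  from (i , lt) = Equivalence.from W≡0⇔ (winning≡0 (bidSeq b) s i refl len≤
    (subst (λ n → Σv s < n + s i) (sym (count-multiset b i)) (≰⇒> (λ le → <⇒≱ lt (m+n≤o⇒m≤o∸n (b i) le)))))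

module _ (s : Fin v → ℕ) (k : Fin v) (s≤sk : ∀ j → s j ≤ s k) {m : ℕ} (m≤c : m ≤ Σv s) where

  IsMinPr-bound : IsMinPr s m (Pr-bound (s k) (Σv s) m)
  IsMinPr-bound = (alwaysBid k m , Σv-alwaysBid k m , Pr-single s (alwaysBid k m) k refl (*-δ-refl m k) (λ _ → *-δ-≢ m) m≤c)
                , λ b Σb≡m → Pr≥bound s b s≤sk Σb≡m m≤c

  IsMinPr-0⇔ : IsMinPr s m 0ℚ ⇔ (Σv s ∸ s k < m)
  IsMinPr-0⇔ = mk⇔ to from
    where
    to : IsMinPr s m 0ℚ → Σv s ∸ s k < m
    to ((b , Σb≡m , Pr≡0) , _) with Equivalence.to (Pr≡0⇔ s b Σb≡m m≤c) Pr≡0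
    ... | i , c∸si<bi = <-≤-trans (≤-<-trans (∸-monoʳ-≤ (Σv s) (s≤sk i)) c∸si<bi) (subst (b i ≤_) Σb≡m (≤Σv b i))
    from : Σv s ∸ s k < m → IsMinPr s m 0ℚ
    from c∸sk<m = (alwaysBid k m , Σv-alwaysBid k m , Equivalence.from (Pr≡0⇔ s (alwaysBid k m) (Σv-alwaysBid k m) m≤c)
                    (k , subst (Σv s ∸ s k <_) (sym (*-δ-refl m k)) c∸sk<m))
                , λ b _ → 0≤Pr b s

corollary1p6 : (v : ℕ) → (hv : 2 ≤ v) → (s : Fin v → ℕ) →
    (∀ (i j : Fin v) → i Data.Fin.≤ j → s j ≤ s i) →
    (∀ (i : Fin v) → 1 ≤ s i) →
    (m : ℕ) → m ≤ Σv s →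
    let c = Σv s
        s₁ = s (first hv)
    in (IsMinPr s m 0ℚ ⇔ (c ∸ s₁ < m))
       × (c ∸ s₁ < m → ∀ (b : Fin v → ℕ) → Σv b ≡ m →
            (Pr b s ≡ 0ℚ ⇔ (∃[ i ] (c ∸ s i < b i))))
       × (m ≤ c ∸ s₁ →
            IsMinPr s m (prodℚ m (λ i → frac (c ∸ s₁ ∸ i) (c ∸ i)))
            × (∀ (b : Fin v → ℕ) → Σv b ≡ m →
                (Pr b s ≡ prodℚ m (λ i → frac (c ∸ s₁ ∸ i) (c ∸ i))
                  ⇔ (∃[ j ] (s j ≡ s₁ × b j ≡ m × (∀ (i : Fin v) → i ≢ j → b i ≡ 0))))))
corollary1p6 (suc v) hv s sorted _ m m≤c =
    IsMinPr-0⇔ s (first hv) s≤s₁ m≤c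
  , (λ _ b Σb≡m → Pr≡0⇔ s b Σb≡m m≤c)
  , λ m≤c∸s₁ → IsMinPr-bound s (first hv) s≤s₁ m≤c
             , λ b Σb≡m → mk⇔ (Pr≡bound⇒single s (first hv) b s≤s₁ Σb≡m m≤c∸s₁)
                              (λ (j , sj≡s₁ , bj≡m , b≡0) → Pr-single s b j sj≡s₁ bj≡m b≡0 m≤c)
  where
  s≤s₁ : ∀ j → s j ≤ s (first hv)
  s≤s₁ j = sorted (first hv) j z≤n
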